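{- Let $T$ be a type, $\Gamma_{ext}=\mathit{in}:[T]^\omega,\ \mathit{out}:[T]^\omega$, and let $M$ be a resource environment containing the channels $\mathit{in},\mathit{out},b,d,c_1$. Then for every $n\in\mathbb N$, it is not the case that $\Gamma_{ext}\models M\triangleright\mathrm{Buff}\ \sqsubseteq^n_{bis}\ M\triangleright\mathrm{eBuff}$.
   Context: Calculus. Fix disjoint countably infinite sets $\mathcal C$ of channel names ($c,d$) and $\mathcal V$ of variables ($x,y,z,w$); identifiers $u,v$ range over $\mathcal C\cup\mathcal V$. Processes: $P,Q::= u!\langle\vec v\rangle.P \mid u?(\vec x).P\mid \mathbf 0\mid \mathsf{if}\ u=v\ \mathsf{then}\ P\ \mathsf{else}\ Q\mid \mathsf{rec}\,w.P\mid w\mid P\parallel Q\mid \mathsf{alloc}\,x.P\mid \mathsf{free}\,u.P$ (input binds $\vec x$, $\mathsf{rec}$ binds $w$, $\mathsf{alloc}$ binds $x$; no name restriction); $u!\langle\vec v\rangle$ abbreviates $u!\langle\vec v\rangle.\mathbf 0$. A resource environment $M$ is a set of allocated channels (infinitely many unallocated); $M,c$ denotes $M\cup\{c\}$ with $c\notin M$. A system $M\triangleright P$ pairs a resource environment with a closed process. Types: attributes $a::=\omega\mid1\mid\bullet i$ ($i\in\mathbb N$, $\bullet=\bullet0$); types $T::=U\mid\mathsf{proc}$, $U::=[\vec U]^a\mid\mu X.U\mid X$, closed contractive, up to equi-recursive equality $\sim$. Environments $\Gamma$: finite multisets of $u:T$. Splitting $[\vec T]^\omega=[\vec T]^\omega\circ[\vec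 T]^\omega$, $\mathsf{proc}=\mathsf{proc}\circ\mathsf{proc}$, $[\vec T]^{\bullet i}=[\vec T]^1\circ[\vec T]^{\bullet(i+1)}$; subtyping generated by $\bullet i\preceq\bullet(i+1)$, $\bullet i\preceq\omega$, $\omega\preceq1$ lifted to channel types. $\prec$: least reflexive transitive relation with $\Gamma,u:T\prec\Gamma,u:T_1,u:T_2$ and converse when $T=T_1\circ T_2$; $\Gamma,u:T_1\prec\Gamma,u:T_2$ when $T_1\sim T_2$ or $T_1\preceq T_2$; $\Gamma,u:T\prec\Gamma$; $\Gamma,u:[\vec T_1]^\bullet\prec\Gamma,u:[\vec T_2]^\bullet$. Decrement $(u:[\vec T]^a-1)$: empty if $a=1$, $u:[\vec T]^\omega$ if $a=\omega$, $u:[\vec T]^{\bullet i}$ if $a=\bullet(i+1)$, undefined if $a=\bullet$. Typing $\Gamma\vdash P$: $\Gamma,(u:[\vec T]^a-1)\vdash P\Rightarrow\Gamma,u:[\vec T]^a,\vec v:\vec T\vdash u!\langle\vec v\rangle.P$; $\Gamma,(u:[\vec T]^a-1),\vec x:\vec T\vdash P\Rightarrow\Gamma,u:[\vec T]^a\vdash u?(\vec x).P$; $\Gamma_1\vdash P,\Gamma_2\vdash Q\Rightarrow\Gamma_1,\Gamma_2\vdash P\parallel Q$; $u,v\in\mathrm{dom}(\Gamma),\Gamma\vdash P,\Gamma\vdash Q\Rightarrow\Gamma\vdash\mathsf{if}\ u=v\ \mathsf{then}\ P\ \mathsf{else}\ Q$; $\Gamma^\omega,w:\mathsf{proc}\vdash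 P\Rightarrow\Gamma^\omega\vdash\mathsf{rec}\,w.P$ ($\Gamma^\omega$ only unrestricted assumptions); $w:\mathsf{proc}\vdash w$; $\Gamma\vdash P\Rightarrow\Gamma,u:[\vec T]^\bullet\vdash\mathsf{free}\,u.P$; $\Gamma,x:[\vec T]^\bullet\vdash P\Rightarrow\Gamma\vdash\mathsf{alloc}\,x.P$; $\emptyset\vdash\mathbf0$; $\Gamma'\vdash P,\Gamma\prec\Gamma'\Rightarrow\Gamma\vdash P$. $\Gamma$ consistent iff some $\Gamma'$ with each identifier at most once has $\Gamma'\prec\Gamma$. $\Gamma\vdash M\triangleright P$ iff $\Gamma\vdash P$, $\mathrm{dom}(\Gamma)\subseteq M$, $\Gamma$ consistent. Configuration $\Gamma\triangleleft M\triangleright P$: $\mathrm{dom}(\Gamma)\subseteq M$ and some $\Delta$ with $(\Gamma,\Delta)$ consistent and $\Delta\vdash M\triangleright P$. LTS: pre-transitions $\Gamma\triangleleft M\triangleright P\xrightarrow{\mu}{}^{\mathrm{pre}}_k\Gamma'\triangleleft M'\triangleright P'$, $\mu::=c!\vec d\mid c?\vec d\mid\tau\mid\mathsf{alloc}\mid\mathsf{free}\,c\mid\mathsf{env}$: output $\Gamma,c:[\vec T]^a\triangleleft M\triangleright c!\langle\vec d\rangle.P\xrightarrow{c!\vec d}_0\Gamma,(c:[\vec T]^a-1),\vec d:\vec T\triangleleft M\triangleright P$; input $\Gamma,c:[\vec T]^a,\vec d:\vec T\triangleleft M\triangleright c?(\vec x).P\xrightarrow{c?\vec d}_0\Gamma,(c:[\vec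 T]^a-1)\triangleleft M\triangleright P\{\vec d/\vec x\}$; communication: if $\Gamma_1\triangleleft M\triangleright P\xrightarrow{c!\vec d}_0\Gamma'_1\triangleleft M\triangleright P'$ and $\Gamma_2\triangleleft M\triangleright Q\xrightarrow{c?\vec d}_0\Gamma'_2\triangleleft M\triangleright Q'$ then $\Gamma\triangleleft M\triangleright P\parallel Q\xrightarrow{\tau}_0\Gamma\triangleleft M\triangleright P'\parallel Q'$ for any $\Gamma$ (and symmetrically); parallel closure on either side; $\Gamma\triangleleft M\triangleright P\xrightarrow{\mathsf{env}}_0\Gamma'\triangleleft M\triangleright P$ for $\Gamma\prec\Gamma'$; cost-0 $\tau$ for recursion unfolding and conditionals (then-branch for $\mathsf{if}\ c=c$, $c\in M$; else-branch for $\mathsf{if}\ c=d$, $c\neq d$, $c,d\in M$); $\Gamma\triangleleft M\triangleright\mathsf{alloc}\,x.P\xrightarrow{\tau}_{+1}\Gamma\triangleleft M,c\triangleright P\{c/x\}$; $\Gamma\triangleleft M\triangleright P\xrightarrow{\mathsf{alloc}}_{+1}\Gamma,c:[\vec T]^\bullet\triangleleft M,c\triangleright P$; $\Gamma\triangleleft M,c\triangleright\mathsf{free}\,c.P\xrightarrow{\tau}_{ -1}\Gamma\triangleleft M\triangleright P$; $\Gamma,c:[\vec T]^\bullet\triangleleft M,c\triangleright P\xrightarrow{\mathsf{free}\,c}_{ -1}\Gamma\triangleleft M\triangleright P$. Transitions $\Gamma\triangleleft M\triangleright P\xrightarrow{\mu}_kX$ iff $\Gamma\triangleleft(M\triangleright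 P)\sigma\xrightarrow{\mu}{}^{\mathrm{pre}}_kX$ for some bijective renaming $\sigma$ of channels fixing all channels in $\mathrm{dom}(\Gamma)$. Weak $\xRightarrow{\mu}_k$: $\tau$-steps, one $\mu$-step, $\tau$-steps, total cost $k$; $\hat\mu=\mu$ for $\mu\ne\tau$, and $\xRightarrow{\hat\tau}_k$ is zero or more $\tau$-steps of total cost $k$. Bisimulation: an amortised typed bisimulation is a set $\mathcal R$ of quadruples $(\Gamma,n,S,T)$, $n\in\mathbb N$, with $\Gamma\triangleleft S,\Gamma\triangleleft T$ configurations, such that whenever $(\Gamma,n,M\triangleright P,N\triangleright Q)\in\mathcal R$: each $\Gamma\triangleleft M\triangleright P\xrightarrow{\mu}_k\Gamma'\triangleleft M'\triangleright P'$ is matched by some $\Gamma\triangleleft N\triangleright Q\xRightarrow{\hat\mu}_l\Gamma'\triangleleft N'\triangleright Q'$ with $(\Gamma',n+l-k,M'\triangleright P',N'\triangleright Q')\in\mathcal R$, and each $\Gamma\triangleleft N\triangleright Q\xrightarrow{\mu}_l\Gamma'\triangleleft N'\triangleright Q'$ is matched by some $\Gamma\triangleleft M\triangleright P\xRightarrow{\hat\mu}_k\Gamma'\triangleleft M'\triangleright P'$ with $(\Gamma',n+l-k,M'\triangleright P',N'\triangleright Q')\in\mathcal R$ (credits stay in $\mathbb N$). $\Gamma\models S\sqsubseteq^n_{bis}T$ iff some amortised typed bisimulation contains $(\Gamma,n,S,T)$. Buffers (with $\mathit{in},\mathit{out},b,d,c_1$ distinct channels): $\mathrm{Frn}=\mathsf{rec}\,w.\,b?(x).\,\mathit{in}?(y).\,\mathsf{alloc}\,z.(w\parallel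 b!\langle z\rangle\parallel x!\langle y,z\rangle)$; $\mathrm{Bck}=\mathsf{rec}\,w.\,d?(x).\,x?(y,z).\,\mathit{out}!\langle y\rangle.(w\parallel d!\langle z\rangle)$; $\mathrm{eBk}=\mathsf{rec}\,w.\,d?(x).\,x?(y,z).\,\mathsf{free}\,x.\,\mathit{out}!\langle y\rangle.(w\parallel d!\langle z\rangle)$; $\mathrm{Buff}=\mathit{in}?(y).\mathsf{alloc}\,z.(\mathrm{Frn}\parallel b!\langle z\rangle\parallel c_1!\langle y,z\rangle)\parallel c_1?(y,z).\mathit{out}!\langle y\rangle.(\mathrm{Bck}\parallel d!\langle z\rangle)$; $\mathrm{eBuff}=\mathit{in}?(y).\mathsf{alloc}\,z.(\mathrm{Frn}\parallel b!\langle z\rangle\parallel c_1!\langle y,z\rangle)\parallel c_1?(y,z).\mathsf{free}\,c_1.\mathit{out}!\langle y\rangle.(\mathrm{eBk}\parallel d!\langle z\rangle)$. -}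

module Defs where

open import Data.Nat using (ℕ; zero; suc; _≤_; _≟_)
open import Data.Integer as ℤ using (ℤ; 0ℤ; 1ℤ; -1ℤ; +_)
open import Data.List using (List; []; _∷_; _++_; map; zipWith; zip; length)
open import Data.List.Membership.Propositional using (_∈_; _∉_)
open import Data.List.Relation.Unary.All using (All)
open import Data.List.Relation.Unary.Any using (Any)
open import Data.List.Relation.Unary.Unique.Propositional using (Unique)
open import Data.List.Relation.Binary.Pointwise using (Pointwise)
open import Data.List.Relation.Binary.Permutation.Propositional using (_↭_)
open import Data.Product using (Σ; ∃; _×_; _,_; proj₁; proj₂)
open import Data.Sum using (_⊎_)
open import Data.Maybe using (Maybe; just; nothing)
open import Data.Bool using (Bool; true; false; if_then_else_)
open import Data.Unit using (⊤)
open import Relation.Nullary using (¬_; yes; no)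
open import Relation.Binary.PropositionalEquality using (_≡_; _≢_)
open import Relation.Binary.Construct.Closure.ReflexiveTransitive using (Star)

data Id : Set where
  ch : ℕ → Id
  vr : ℕ → Id

data Proc : Set where
  snd   : Id → List Id → Proc → Proc
  rcv   : Id → List ℕ → Proc → Proc           -- u?(x⃗).P   (binds x⃗)
  nil   : Proc
  ite   : Id → Id → Proc → Proc → Proc
  rec   : ℕ → Proc → Proc                     -- rec w.P   (binds w)
  pvar  : ℕ → Proc
  _∥_   : Proc → Proc → Proc
  alloc : ℕ → Proc → Proc                     -- alloc x.P (binds x)
  free  : Id → Proc → Proc

infixr 5 _∥_

-- free variables (value and process variables share 𝒱)
data FreeIn (x : ℕ) : Proc → Set where
  snd-s   : ∀ {vs P} → FreeIn x (snd (vr x) vs P)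
  snd-a   : ∀ {u vs P} → vr x ∈ vs → FreeIn x (snd u vs P)
  snd-c   : ∀ {u vs P} → FreeIn x P → FreeIn x (snd u vs P)
  rcv-s   : ∀ {xs P} → FreeIn x (rcv (vr x) xs P)
  rcv-c   : ∀ {u xs P} → x ∉ xs → FreeIn x P → FreeIn x (rcv u xs P)
  ite-l   : ∀ {v P Q} → FreeIn x (ite (vr x) v P Q)
  ite-r   : ∀ {u P Q} → FreeIn x (ite u (vr x) P Q)
  ite-1   : ∀ {u v P Q} → FreeIn x P → FreeIn x (ite u v P Q)
  ite-2   : ∀ {u v P Q} → FreeIn x Q → FreeIn x (ite u v P Q)
  rec-c   : ∀ {w P} → x ≢ w → FreeIn x P → FreeIn x (rec w P)
  pvar-s  : FreeIn x (pvar x)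
  par-l   : ∀ {P Q} → FreeIn x P → FreeIn x (P ∥ Q)
  par-r   : ∀ {P Q} → FreeIn x Q → FreeIn x (P ∥ Q)
  alloc-c : ∀ {y P} → x ≢ y → FreeIn x P → FreeIn x (alloc y P)
  free-s  : ∀ {P} → FreeIn x (free (vr x) P)
  free-c  : ∀ {u P} → FreeIn x P → FreeIn x (free u P)

ClosedP : Proc → Set
ClosedP P = ∀ x → ¬ FreeIn x P

mem : ℕ → List ℕ → Bool
mem x [] = false
mem x (y ∷ ys) with x ≟ y
... | yes _ = true
... | no _ = mem x ys

-- substitution of channels for variables: an association list x ↦ c
Sub : Set
Sub = List (ℕ × ℕ)

lookupS : Sub → ℕ → Maybe ℕ
lookupS [] x = nothing
lookupS ((y , c) ∷ σ) x with x ≟ y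
... | yes _ = just c
... | no _ = lookupS σ x

removeS : List ℕ → Sub → Sub
removeS xs [] = []
removeS xs ((y , c) ∷ σ) = if mem y xs then removeS xs σ else (y , c) ∷ removeS xs σ

substId : Sub → Id → Id
substId σ (ch c) = ch c
substId σ (vr x) with lookupS σ x
... | just c = ch c
... | nothing = vr x

substP : Sub → Proc → Proc
substP σ (snd u vs P) = snd (substId σ u) (map (substId σ) vs) (substP σ P)
substP σ (rcv u xs P) = rcv (substId σ u) xs (substP (removeS xs σ) P)
substP σ nil = nil
substP σ (ite u v P Q) = ite (substId σ u) (substId σ v) (substP σ P) (substP σ Q)
substP σ (rec w P) = rec w (substP (removeS (w ∷ []) σ) P)
substP σ (pvar w) = pvar w
substP σ (P ∥ Q) = substP σ P ∥ substP σ Q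
substP σ (alloc x P) = alloc x (substP (removeS (x ∷ []) σ) P)
substP σ (free u P) = free (substId σ u) (substP σ P)

-- P{R/w} for a closed process R (no capture possible)
substR : ℕ → Proc → Proc → Proc
substR w R (snd u vs P) = snd u vs (substR w R P)
substR w R (rcv u xs P) = if mem w xs then rcv u xs P else rcv u xs (substR w R P)
substR w R nil = nil
substR w R (ite u v P Q) = ite u v (substR w R P) (substR w R Q)
substR w R (rec w' P) with w ≟ w'
... | yes _ = rec w' P
... | no _ = rec w' (substR w R P)
substR w R (pvar w') with w ≟ w'
... | yes _ = R
... | no _ = pvar w'
substR w R (P ∥ Q) = substR w R P ∥ substR w R Q
substR w R (alloc x P) with w ≟ x
... | yes _ = alloc x P
... | no _ = alloc x (substR w R P)
substR w R (free u P) = free u (substR w R P)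

renId : (ℕ → ℕ) → Id → Id
renId f (ch c) = ch (f c)
renId f (vr x) = vr x

renP : (ℕ → ℕ) → Proc → Proc
renP f (snd u vs P) = snd (renId f u) (map (renId f) vs) (renP f P)
renP f (rcv u xs P) = rcv (renId f u) xs (renP f P)
renP f nil = nil
renP f (ite u v P Q) = ite (renId f u) (renId f v) (renP f P) (renP f Q)
renP f (rec w P) = rec w (renP f P)
renP f (pvar w) = pvar w
renP f (P ∥ Q) = renP f P ∥ renP f Q
renP f (alloc x P) = alloc x (renP f P)
renP f (free u P) = free (renId f u) (renP f P)

data Attr : Set where
  ω   : Attr
  one : Attr
  bul : ℕ → Attr

data Ty : Set where
  chan : List Ty → Attr → Ty
  mu   : ℕ → Ty → Ty
  tv   : ℕ → Ty

mutual
  substT : ℕ → Ty → Ty → Ty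
  substT X S (chan Us a) = chan (substTs X S Us) a
  substT X S (mu Y U) with X ≟ Y
  ... | yes _ = mu Y U
  ... | no _ = mu Y (substT X S U)
  substT X S (tv Y) with X ≟ Y
  ... | yes _ = S
  ... | no _ = tv Y

  substTs : ℕ → Ty → List Ty → List Ty
  substTs X S [] = []
  substTs X S (U ∷ Us) = substT X S U ∷ substTs X S Us

data FreeTv (X : ℕ) : Ty → Set where
  tvF : FreeTv X (tv X)
  chF : ∀ {Us a} → Any (FreeTv X) Us → FreeTv X (chan Us a)
  muF : ∀ {Y U} → X ≢ Y → FreeTv X U → FreeTv X (mu Y U)

ClosedT : Ty → Set
ClosedT T = ∀ X → ¬ FreeTv X T

-- Guard bs U: after stripping leading μ's from U, it is not a variable
-- bound by the chain (bs = names bound so far)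
Guard : List ℕ → Ty → Set
Guard bs (chan _ _) = ⊤
Guard bs (tv Z) = Z ∉ bs
Guard bs (mu Y U) = Guard (Y ∷ bs) U

data Contr : Ty → Set where
  cch : ∀ {Us a} → All Contr Us → Contr (chan Us a)
  ctv : ∀ {X} → Contr (tv X)
  cmu : ∀ {X U} → Guard (X ∷ []) U → Contr U → Contr (mu X U)

ValidT : Ty → Set
ValidT T = ClosedT T × Contr T

data PTy : Set where
  ty   : Ty → PTy
  proc : PTy

ValidP : PTy → Set
ValidP (ty T) = ValidT T
ValidP proc = ⊤

data Unf : Ty → Ty → Set where
  here : ∀ {Us a} → Unf (chan Us a) (chan Us a)
  step : ∀ {X U T} → Unf (substT X (mu X U) U) T → Unf (mu X U) T

-- k-th approximation of equi-recursive equality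
EqK : ℕ → Ty → Ty → Set
EqK zero T U = ⊤
EqK (suc k) T U =
  Σ (List Ty) λ Us → Σ (List Ty) λ Vs → Σ Attr λ a →
    Unf T (chan Us a) × Unf U (chan Vs a) × Pointwise (EqK k) Us Vs

_∼T_ : Ty → Ty → Set
T ∼T U = ∀ k → EqK k T U

data _∼_ : PTy → PTy → Set where
  ty∼   : ∀ {T U} → T ∼T U → ty T ∼ ty U
  proc∼ : proc ∼ proc

data _⊑_ : Attr → Attr → Set where
  ⊑-refl  : ∀ {a} → a ⊑ a
  ⊑-trans : ∀ {a b c} → a ⊑ b → b ⊑ c → a ⊑ c
  ⊑-bb    : ∀ {i} → bul i ⊑ bul (suc i)
  ⊑-bω    : ∀ {i} → bul i ⊑ ω
  ⊑-ω1    : ω ⊑ one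

data _⪯_ : PTy → PTy → Set where
  sub : ∀ {Ts a b} → a ⊑ b → ty (chan Ts a) ⪯ ty (chan Ts b)

data Split : PTy → PTy → PTy → Set where
  sω    : ∀ {Ts} → Split (ty (chan Ts ω)) (ty (chan Ts ω)) (ty (chan Ts ω))
  sproc : Split proc proc proc
  sbul  : ∀ {Ts i} → Split (ty (chan Ts (bul i))) (ty (chan Ts one)) (ty (chan Ts (bul (suc i))))

-- Environments (lists read as multisets: permutation is a ≺-step)

Env : Set
Env = List (Id × PTy)

dom : Env → List Id
dom = map proj₁

WfEnv : Env → Set
WfEnv Γ = All (λ e → ValidP (proj₂ e)) Γ

data Step : Env → Env → Set where
  perm  : ∀ {Γ Δ} → Γ ↭ Δ → Step Γ Δ
  split : ∀ {Γ u T T₁ T₂} → Split T T₁ T₂ → Step ((u , T) ∷ Γ) ((u , T₁) ∷ (u , T₂) ∷ Γ)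
  join  : ∀ {Γ u T T₁ T₂} → Split T T₁ T₂ → Step ((u , T₁) ∷ (u , T₂) ∷ Γ) ((u , T) ∷ Γ)
  equiv : ∀ {Γ u T₁ T₂} → T₁ ∼ T₂ → ValidP T₂ → Step ((u , T₁) ∷ Γ) ((u , T₂) ∷ Γ)
  subty : ∀ {Γ u T₁ T₂} → T₁ ⪯ T₂ → Step ((u , T₁) ∷ Γ) ((u , T₂) ∷ Γ)
  weak  : ∀ {Γ u T} → Step ((u , T) ∷ Γ) Γ
  rebul : ∀ {Γ u Ts₁ Ts₂} → ValidT (chan Ts₂ (bul 0)) →
          Step ((u , ty (chan Ts₁ (bul 0))) ∷ Γ) ((u , ty (chan Ts₂ (bul 0))) ∷ Γ)

_≺_ : Env → Env → Set
_≺_ = Star Step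

decr : Id → List Ty → Attr → Maybe Env
decr u Ts ω = just ((u , ty (chan Ts ω)) ∷ [])
decr u Ts one = just []
decr u Ts (bul zero) = nothing
decr u Ts (bul (suc i)) = just ((u , ty (chan Ts (bul i))) ∷ [])

zipEnv : List Id → List Ty → Env
zipEnv = zipWith (λ u T → (u , ty T))

data Unr : Id × PTy → Set where
  unr-ω    : ∀ {u Ts} → Unr (u , ty (chan Ts ω))
  unr-proc : ∀ {u} → Unr (u , proc)

data _⊢_ : Env → Proc → Set where
  t-out   : ∀ {Γ D u vs Ts a P} → decr u Ts a ≡ just D → (D ++ Γ) ⊢ P → length vs ≡ length Ts →
            ((u , ty (chan Ts a)) ∷ zipEnv vs Ts ++ Γ) ⊢ snd u vs P
  t-in    : ∀ {Γ D u xs Ts a P} → decr u Ts a ≡ just D → (D ++ zipEnv (map vr xs) Ts ++ Γ) ⊢ P →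
            length xs ≡ length Ts → ((u , ty (chan Ts a)) ∷ Γ) ⊢ rcv u xs P
  t-par   : ∀ {Γ₁ Γ₂ P Q} → Γ₁ ⊢ P → Γ₂ ⊢ Q → (Γ₁ ++ Γ₂) ⊢ (P ∥ Q)
  t-if    : ∀ {Γ u v P Q} → u ∈ dom Γ → v ∈ dom Γ → Γ ⊢ P → Γ ⊢ Q → Γ ⊢ ite u v P Q
  t-rec   : ∀ {Γ w P} → All Unr Γ → ((vr w , proc) ∷ Γ) ⊢ P → Γ ⊢ rec w P
  t-var   : ∀ {w} → ((vr w , proc) ∷ []) ⊢ pvar w
  t-free  : ∀ {Γ u Ts P} → Γ ⊢ P → ((u , ty (chan Ts (bul 0))) ∷ Γ) ⊢ free u P
  t-alloc : ∀ {Γ x Ts P} → ValidT (chan Ts (bul 0)) → ((vr x , ty (chan Ts (bul 0))) ∷ Γ) ⊢ P →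
            Γ ⊢ alloc x P
  t-nil   : [] ⊢ nil
  t-sub   : ∀ {Γ Γ' P} → Γ ≺ Γ' → Γ' ⊢ P → Γ ⊢ P

Consistent : Env → Set
Consistent Γ = Σ Env λ Γ' → WfEnv Γ' × Unique (dom Γ') × (Γ' ≺ Γ)

InfFree : (ℕ → Set) → Set
InfFree M = ∀ k → Σ ℕ λ c → k ≤ c × ¬ M c

record Sys : Set₁ where
  constructor _▷_
  field
    res : ℕ → Set
    prc : Proc
open Sys public

DomIn : Env → (ℕ → Set) → Set
DomIn Γ M = All (λ e → Σ ℕ λ c → proj₁ e ≡ ch c × M c) Γ

SysTyped : Env → Sys → Set
SysTyped Γ S = (Γ ⊢ prc S) × DomIn Γ (res S) × Consistent Γ

Config : Env → Sys → Set
Config Γ S = WfEnv Γ × InfFree (res S) × ClosedP (prc S) × DomIn Γ (res S) ×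
             Σ Env λ Δ → WfEnv Δ × Consistent (Γ ++ Δ) × SysTyped Δ S

_≈E_ : Env → Env → Set
Γ ≈E Δ = Σ Env λ Θ → Pointwise (λ e e' → proj₁ e ≡ proj₁ e' × proj₂ e ∼ proj₂ e') Γ Θ × Θ ↭ Δ

addR : (ℕ → Set) → ℕ → (ℕ → Set)
addR M c = λ e → M e ⊎ e ≡ c

delR : (ℕ → Set) → ℕ → (ℕ → Set)
delR M c = λ e → M e × e ≢ c

data Label : Set where
  outL   : ℕ → List ℕ → Label
  inL    : ℕ → List ℕ → Label
  tau    : Label
  allocL : Label
  freeL  : ℕ → Label
  envL   : Label

data Pre : Env → Sys → Label → ℤ → Env → Sys → Set₁ where
  p-out   : ∀ {Γ Γ₀ Γ' M c ds Ts a D P} →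
            Γ ≈E ((ch c , ty (chan Ts a)) ∷ Γ₀) → decr (ch c) Ts a ≡ just D → length ds ≡ length Ts →
            Γ' ≈E (D ++ zipEnv (map ch ds) Ts ++ Γ₀) →
            Pre Γ (M ▷ snd (ch c) (map ch ds) P) (outL c ds) 0ℤ Γ' (M ▷ P)
  p-in    : ∀ {Γ Γ₀ Γ' M c ds xs Ts a D P} →
            Γ ≈E ((ch c , ty (chan Ts a)) ∷ zipEnv (map ch ds) Ts ++ Γ₀) → decr (ch c) Ts a ≡ just D →
            length ds ≡ length Ts → length xs ≡ length ds → Γ' ≈E (D ++ Γ₀) →
            Pre Γ (M ▷ rcv (ch c) xs P) (inL c ds) 0ℤ Γ' (M ▷ substP (zip xs ds) P)
  p-comL  : ∀ {Γ Γ₁ Γ₁' Γ₂ Γ₂' M c ds P P' Q Q'} →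
            Pre Γ₁ (M ▷ P) (outL c ds) 0ℤ Γ₁' (M ▷ P') → Pre Γ₂ (M ▷ Q) (inL c ds) 0ℤ Γ₂' (M ▷ Q') →
            Pre Γ (M ▷ (P ∥ Q)) tau 0ℤ Γ (M ▷ (P' ∥ Q'))
  p-comR  : ∀ {Γ Γ₁ Γ₁' Γ₂ Γ₂' M c ds P P' Q Q'} →
            Pre Γ₁ (M ▷ P) (inL c ds) 0ℤ Γ₁' (M ▷ P') → Pre Γ₂ (M ▷ Q) (outL c ds) 0ℤ Γ₂' (M ▷ Q') →
            Pre Γ (M ▷ (P ∥ Q)) tau 0ℤ Γ (M ▷ (P' ∥ Q'))
  p-parL  : ∀ {Γ Γ' M M' P P' Q μ k} → Pre Γ (M ▷ P) μ k Γ' (M' ▷ P') →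
            Pre Γ (M ▷ (P ∥ Q)) μ k Γ' (M' ▷ (P' ∥ Q))
  p-parR  : ∀ {Γ Γ' M M' P Q Q' μ k} → Pre Γ (M ▷ Q) μ k Γ' (M' ▷ Q') →
            Pre Γ (M ▷ (P ∥ Q)) μ k Γ' (M' ▷ (P ∥ Q'))
  p-env   : ∀ {Γ Γ' S} → Γ ≺ Γ' → Pre Γ S envL 0ℤ Γ' S
  p-rec   : ∀ {Γ M w P} → Pre Γ (M ▷ rec w P) tau 0ℤ Γ (M ▷ substR w (rec w P) P)
  p-then  : ∀ {Γ M c P Q} → M c → Pre Γ (M ▷ ite (ch c) (ch c) P Q) tau 0ℤ Γ (M ▷ P)
  p-else  : ∀ {Γ M c d P Q} → c ≢ d → M c → M d → Pre Γ (M ▷ ite (ch c) (ch d) P Q) tau 0ℤ Γ (M ▷ Q)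
  p-alloc : ∀ {Γ M c x P} → ¬ M c →
            Pre Γ (M ▷ alloc x P) tau 1ℤ Γ (addR M c ▷ substP ((x , c) ∷ []) P)
  p-allocE : ∀ {Γ Γ' M c Ts P} → ¬ M c → ValidT (chan Ts (bul 0)) →
            Γ' ≈E ((ch c , ty (chan Ts (bul 0))) ∷ Γ) →
            Pre Γ (M ▷ P) allocL 1ℤ Γ' (addR M c ▷ P)
  p-free  : ∀ {Γ M c P} → M c → Pre Γ (M ▷ free (ch c) P) tau -1ℤ Γ (delR M c ▷ P)
  p-freeE : ∀ {Γ Γ₀ Γ' M c Ts P} → M c → Γ ≈E ((ch c , ty (chan Ts (bul 0))) ∷ Γ₀) → Γ' ≈E Γ₀ →
            Pre Γ (M ▷ P) (freeL c) -1ℤ Γ' (delR M c ▷ P)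

record Bij : Set where
  field
    f  : ℕ → ℕ
    g  : ℕ → ℕ
    fg : ∀ x → f (g x) ≡ x
    gf : ∀ x → g (f x) ≡ x
open Bij public

renSys : Bij → Sys → Sys
renSys σ (M ▷ P) = (λ c → M (g σ c)) ▷ renP (f σ) P

Trans : Env → Sys → Label → ℤ → Env → Sys → Set₁
Trans Γ S μ k Γ' S' =
  Σ Bij λ σ → (∀ c → ch c ∈ dom Γ → f σ c ≡ c) × Pre Γ (renSys σ S) μ k Γ' S'

data Taus : Env → Sys → ℤ → Env → Sys → Set₁ where
  none : ∀ {Γ S} → Taus Γ S 0ℤ Γ S
  more : ∀ {Γ Γ₁ Γ₂ S S₁ S₂ k l} → Trans Γ S tau k Γ₁ S₁ → Taus Γ₁ S₁ l Γ₂ S₂ →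
         Taus Γ S (k ℤ.+ l) Γ₂ S₂

Weak : Env → Sys → Label → ℤ → Env → Sys → Set₁
Weak Γ S μ k Γ' S' =
  Σ Env λ Γ₁ → Σ Sys λ S₁ → Σ Env λ Γ₂ → Σ Sys λ S₂ → Σ ℤ λ k₁ → Σ ℤ λ k₂ → Σ ℤ λ k₃ →
    Taus Γ S k₁ Γ₁ S₁ × Trans Γ₁ S₁ μ k₂ Γ₂ S₂ × Taus Γ₂ S₂ k₃ Γ' S' × k ≡ k₁ ℤ.+ k₂ ℤ.+ k₃

WeakHat : Env → Sys → Label → ℤ → Env → Sys → Set₁
WeakHat Γ S tau k Γ' S' = Taus Γ S k Γ' S'
WeakHat Γ S μ k Γ' S' = Weak Γ S μ k Γ' S'

Rel : Set₁
Rel = Env → ℕ → Sys → Sys → Set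

IsBisim : Rel → Set₁
IsBisim R = ∀ {Γ n S T} → R Γ n S T →
  Config Γ S × Config Γ T ×
  (∀ μ k Γ' S' → Trans Γ S μ k Γ' S' →
     Σ ℤ λ l → Σ Sys λ T' → Σ ℕ λ n' →
       WeakHat Γ T μ l Γ' T' × (+ n') ≡ (+ n) ℤ.+ l ℤ.- k × R Γ' n' S' T') ×
  (∀ μ l Γ' T' → Trans Γ T μ l Γ' T' →
     Σ ℤ λ k → Σ Sys λ S' → Σ ℕ λ n' →
       WeakHat Γ S μ k Γ' S' × (+ n') ≡ (+ n) ℤ.+ l ℤ.- k × R Γ' n' S' T')

Bisimilar : Env → ℕ → Sys → Sys → Set₁
Bisimilar Γ n S T = Σ Rel λ R → IsBisim R × R Γ n S T

module Buffers (inc outc b d c₁ : ℕ) where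
  private
    x y z w : ℕ
    x = 0
    y = 1
    z = 2
    w = 3

  Frn : Proc
  Frn = rec w (rcv (ch b) (x ∷ []) (rcv (ch inc) (y ∷ [])
          (alloc z (pvar w ∥ snd (ch b) (vr z ∷ []) nil ∥ snd (vr x) (vr y ∷ vr z ∷ []) nil))))

  Bck : Proc
  Bck = rec w (rcv (ch d) (x ∷ []) (rcv (vr x) (y ∷ z ∷ [])
          (snd (ch outc) (vr y ∷ []) (pvar w ∥ snd (ch d) (vr z ∷ []) nil))))

  eBk : Proc
  eBk = rec w (rcv (ch d) (x ∷ []) (rcv (vr x) (y ∷ z ∷ []) (free (vr x)
          (snd (ch outc) (vr y ∷ []) (pvar w ∥ snd (ch d) (vr z ∷ []) nil)))))

  front : Proc
  front = rcv (ch inc) (y ∷ []) (alloc z (Frn ∥ snd (ch b) (vr z ∷ []) nil ∥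
            snd (ch c₁) (vr y ∷ vr z ∷ []) nil))

  Buff : Proc
  Buff = front ∥ rcv (ch c₁) (y ∷ z ∷ []) (snd (ch outc) (vr y ∷ []) (Bck ∥ snd (ch d) (vr z ∷ []) nil))

  eBuff : Proc
  eBuff = front ∥ rcv (ch c₁) (y ∷ z ∷ []) (free (ch c₁)
            (snd (ch outc) (vr y ∷ []) (eBk ∥ snd (ch d) (vr z ∷ []) nil)))

open Buffers public

Γext : Ty → ℕ → ℕ → Env
Γext T inc outc = (ch inc , ty (chan (T ∷ []) ω)) ∷ (ch outc , ty (chan (T ∷ []) ω)) ∷ []

-- Suppose R were an amortised bisimulation relating Buff to eBuff. The right-hand side can
-- feed one datum e through the buffer forever: input e on in, allocate a cell, pass it to the
-- back end, free it, output e on out. Such a round costs eBuff nothing, as the free refunds the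
-- allocation. Buff never frees, yet it must allocate a cell before each datum can leave it.
-- Give each reachable state of Buff a potential (the data in transit, each holding a paid-for
-- cell) and each label a weight, so that every move of Buff raises the potential by at most its
-- cost plus the weight of its label. Then credit plus potential of the left side strictly drops
-- in every round, which cannot go on forever.

module Submission where

open import Defs
open import Data.Nat as ℕ using (ℕ; zero; suc; _≟_; z≤n; s≤s)
import Data.Nat.Properties as ℕ
import Data.Nat.Induction as ℕ
open import Data.Integer using (ℤ; +_; -_; 0ℤ; 1ℤ; -1ℤ; _+_; _-_; _≤_; -≤-; +≤+)
import Data.Integer.Properties as ℤ
open import Data.Integer.Tactic.RingSolver using (solve; solve-∀)
open import Data.Bool using (true; false; if_then_else_)
open import Data.List using (List; []; _∷_; map)
open import Data.List.Properties using (map-id-local)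
open import Data.List.Membership.Propositional using (_∈_)
open import Data.List.Relation.Unary.Any using (Any; here; there)
open import Data.List.Relation.Unary.All as All using (All)
open import Data.List.Relation.Unary.All.Properties using (All¬⇒¬Any)
open import Data.List.Relation.Binary.Permutation.Propositional using (_↭_; ↭-refl; ↭-trans; prep; swap)
open import Data.List.Relation.Unary.Unique.Propositional using (Unique)
open import Data.Product using (Σ; ∃; ∃₂; _×_; _,_; proj₁; proj₂)
open import Data.Sum using (_⊎_; inj₁; inj₂)
open import Data.Unit using (tt)
open import Data.Empty using (⊥-elim)
open import Function using (_∘_; id)
open import Induction.InfiniteDescent using (Descent; descent∧wf⇒empty)
open import Relation.Nullary using (¬_; yes; no; does)
open import Relation.Nullary.Decidable using (dec-true; dec-false)
open import Relation.Binary.Construct.Closure.ReflexiveTransitive using (ε; _◅_)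
open import Relation.Binary.PropositionalEquality

-- Equi-recursive types

module _ where
  open import Data.List.Relation.Unary.All using ([]; _∷_)
  open import Data.List.Relation.Binary.Pointwise using (Pointwise; []; _∷_)

  data MuDepth : ℕ → Ty → Set where
    chan : ∀ {Us a} → MuDepth 0 (chan Us a)
    mu   : ∀ {n X U} → MuDepth n U → MuDepth (suc n) (mu X U)

  MuDepth-substT : ∀ {n} X S V → MuDepth n V → MuDepth n (substT X S V)
  MuDepth-substT X S (chan Us a) chan = chan
  MuDepth-substT X S (mu Y U) (mu h) with X ≟ Y
  ... | yes _ = mu h
  ... | no _ = mu (MuDepth-substT X S U h)

  MuDepth⇒Guard : ∀ {n S} → MuDepth n S → ∀ bs → Guard bs S
  MuDepth⇒Guard chan bs = tt
  MuDepth⇒Guard (mu h) bs = MuDepth⇒Guard h _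

  mutual
    freeTv-substT : ∀ X S V Z → FreeTv Z (substT X S V) → FreeTv Z S ⊎ (FreeTv Z V × Z ≢ X)
    freeTv-substT X S (chan Us a) Z (chF p) with freeTv-substTs X S Us Z p
    ... | inj₁ q = inj₁ q
    ... | inj₂ (q , Z≢X) = inj₂ (chF q , Z≢X)
    freeTv-substT X S (mu Y U) Z f with X ≟ Y
    freeTv-substT X S (mu Y U) Z (muF Z≢Y f) | yes refl = inj₂ (muF Z≢Y f , Z≢Y)
    freeTv-substT X S (mu Y U) Z (muF Z≢Y f) | no _ with freeTv-substT X S U Z f
    ... | inj₁ q = inj₁ q
    ... | inj₂ (q , Z≢X) = inj₂ (muF Z≢Y q , Z≢X)
    freeTv-substT X S (tv Y) Z f with X ≟ Y
    ... | yes _ = inj₁ f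
    freeTv-substT X S (tv Y) .Y tvF | no X≢Y = inj₂ (tvF , λ Y≡X → X≢Y (sym Y≡X))

    freeTv-substTs : ∀ X S Us Z → Any (FreeTv Z) (substTs X S Us) →
                     FreeTv Z S ⊎ (Any (FreeTv Z) Us × Z ≢ X)
    freeTv-substTs X S (U ∷ Us) Z (here p) with freeTv-substT X S U Z p
    ... | inj₁ q = inj₁ q
    ... | inj₂ (q , Z≢X) = inj₂ (here q , Z≢X)
    freeTv-substTs X S (U ∷ Us) Z (there p) with freeTv-substTs X S Us Z p
    ... | inj₁ q = inj₁ q
    ... | inj₂ (q , Z≢X) = inj₂ (there q , Z≢X)

  Guard-substT : ∀ X S → (∀ bs → Guard bs S) → ∀ bs V → Guard bs V → Guard bs (substT X S V)
  Guard-substT X S gS bs (chan Us a) g = tt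
  Guard-substT X S gS bs (tv Y) g with X ≟ Y
  ... | yes _ = gS bs
  ... | no _ = g
  Guard-substT X S gS bs (mu Y U) g with X ≟ Y
  ... | yes _ = g
  ... | no _ = Guard-substT X S gS (Y ∷ bs) U g

  mutual
    Contr-substT : ∀ X S → Contr S → (∀ bs → Guard bs S) → ∀ V → Contr V → Contr (substT X S V)
    Contr-substT X S cS gS (chan Us a) (cch cs) = cch (Contr-substTs X S cS gS Us cs)
    Contr-substT X S cS gS (tv Y) c with X ≟ Y
    ... | yes _ = cS
    ... | no _ = ctv
    Contr-substT X S cS gS (mu Y U) (cmu g c) with X ≟ Y
    ... | yes _ = cmu g c
    ... | no _ = cmu (Guard-substT X S gS (Y ∷ []) U g) (Contr-substT X S cS gS U c)

    Contr-substTs : ∀ X S → Contr S → (∀ bs → Guard bs S) → ∀ Us → All Contr Us →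
                    All Contr (substTs X S Us)
    Contr-substTs X S cS gS [] [] = []
    Contr-substTs X S cS gS (U ∷ Us) (c ∷ cs) =
      Contr-substT X S cS gS U c ∷ Contr-substTs X S cS gS Us cs

  Guard⇒MuDepth : ∀ bs U → Guard bs U → (∀ Z → ¬ Any (Z ≡_) bs → ¬ FreeTv Z U) → ∃ λ n → MuDepth n U
  Guard⇒MuDepth bs (chan Us a) g closed = 0 , chan
  Guard⇒MuDepth bs (tv Z) Z∉bs closed = ⊥-elim (closed Z Z∉bs tvF)
  Guard⇒MuDepth bs (mu Y U) g closed
    with Guard⇒MuDepth (Y ∷ bs) U g (λ Z Z∉ f → closed Z (λ m → Z∉ (there m)) (muF (λ eq → Z∉ (here eq)) f))
  ... | n , h = suc n , mu h

  ValidT⇒MuDepth : ∀ {T} → ValidT T → ∃ λ n → MuDepth n T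
  ValidT⇒MuDepth {T} (closed , c) = Guard⇒MuDepth [] T (guard c) (λ Z _ → closed Z)
    where
    guard : ∀ {T} → Contr T → Guard [] T
    guard (cch _) = tt
    guard ctv = λ ()
    guard (cmu g _) = g

  ValidT-unfold : ∀ {X U} → ValidT (mu X U) → ValidT (substT X (mu X U) U)
  ValidT-unfold {X} {U} v@(closed , cmu g c) = closed′ , Contr-substT X (mu X U) (cmu g c) guarded U c
    where
    guarded : ∀ bs → Guard bs (mu X U)
    guarded = MuDepth⇒Guard (proj₂ (ValidT⇒MuDepth v))
    closed′ : ClosedT (substT X (mu X U) U)
    closed′ Z f with freeTv-substT X (mu X U) U Z f
    ... | inj₁ q = closed Z q
    ... | inj₂ (q , Z≢X) = closed Z (muF Z≢X q)

  ValidT⇒Unf : ∀ {T} → ValidT T → ∃₂ λ Us a → Unf T (chan Us a) × ValidT (chan Us a)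
  ValidT⇒Unf {T} v = go (proj₂ (ValidT⇒MuDepth v)) v
    where
    go : ∀ {n T} → MuDepth n T → ValidT T → ∃₂ λ Us a → Unf T (chan Us a) × ValidT (chan Us a)
    go chan v = _ , _ , here , v
    go {T = mu X U} (mu h) v with go (MuDepth-substT X (mu X U) U h) (ValidT-unfold v)
    ... | Us , a , u , v′ = Us , a , step u , v′

  ValidT-chan⁻ : ∀ {Us a} → ValidT (chan Us a) → All ValidT Us
  ValidT-chan⁻ {Us} (closed , cch cs) = go Us (λ X p → closed X (chF p)) cs
    where
    go : ∀ Us → (∀ X → ¬ Any (FreeTv X) Us) → All Contr Us → All ValidT Us
    go [] _ [] = []
    go (U ∷ Us) closed (c ∷ cs) = ((λ X f → closed X (here f)) , c) ∷ go Us (λ X p → closed X (there p)) cs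

  mutual
    EqK-refl : ∀ k {T} → ValidT T → EqK k T T
    EqK-refl zero v = tt
    EqK-refl (suc k) v with ValidT⇒Unf v
    ... | Us , a , u , v′ = Us , Us , a , u , u , EqKs-refl k (ValidT-chan⁻ v′)

    EqKs-refl : ∀ k {Us} → All ValidT Us → Pointwise (EqK k) Us Us
    EqKs-refl k [] = []
    EqKs-refl k (v ∷ vs) = EqK-refl k v ∷ EqKs-refl k vs

  ∼T-refl : ∀ {T} → ValidT T → T ∼T T
  ∼T-refl v k = EqK-refl k v

  Unf⇒∼T : ∀ {T Us a} → ValidT (chan Us a) → Unf T (chan Us a) → chan Us a ∼T T
  Unf⇒∼T v u zero = tt
  Unf⇒∼T v u (suc k) = _ , _ , _ , here , u , EqKs-refl k (ValidT-chan⁻ v)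

  ValidT-chan⁺ : ∀ {Us a} → All ValidT Us → ValidT (chan Us a)
  ValidT-chan⁺ vs = (λ { X (chF p) → All¬⇒¬Any (All.map (λ v → proj₁ v X) vs) p }) , cch (All.map proj₂ vs)

  ∼-refl : ∀ {T} → ValidP T → T ∼ T
  ∼-refl {ty T} v = ty∼ (∼T-refl v)
  ∼-refl {proc} _ = proc∼

  ≈E-refl : ∀ {Γ} → WfEnv Γ → Γ ≈E Γ
  ≈E-refl {Γ} wf = Γ , pointwise wf , ↭-refl
    where
    pointwise : ∀ {Δ} → WfEnv Δ → Pointwise (λ e e′ → proj₁ e ≡ proj₁ e′ × proj₂ e ∼ proj₂ e′) Δ Δ
    pointwise [] = []
    pointwise (v ∷ vs) = (refl , ∼-refl v) ∷ pointwise vs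

  ≈E-↭ : ∀ {Γ Δ} → WfEnv Γ → Γ ↭ Δ → Γ ≈E Δ
  ≈E-↭ wf p = _ , proj₁ (proj₂ (≈E-refl wf)) , p

-- Shapes of the states of Buff

-- Front and Back are Frn and Bck, and Buff inc outc b d c₁ is literally FrontIn inc b c₁ ∥ BackIn outc d c₁.
Front : ℕ → ℕ → Proc
Front i b = rec 3 (rcv (ch b) (0 ∷ []) (rcv (ch i) (1 ∷ [])
  (alloc 2 (pvar 3 ∥ snd (ch b) (vr 2 ∷ []) nil ∥ snd (vr 0) (vr 1 ∷ vr 2 ∷ []) nil))))

Frontᵘ : ℕ → ℕ → Proc
Frontᵘ i b = rcv (ch b) (0 ∷ []) (rcv (ch i) (1 ∷ [])
  (alloc 2 (Front i b ∥ snd (ch b) (vr 2 ∷ []) nil ∥ snd (vr 0) (vr 1 ∷ vr 2 ∷ []) nil)))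

FrontIn : ℕ → ℕ → ℕ → Proc
FrontIn i b c = rcv (ch i) (1 ∷ [])
  (alloc 2 (Front i b ∥ snd (ch b) (vr 2 ∷ []) nil ∥ snd (ch c) (vr 1 ∷ vr 2 ∷ []) nil))

FrontAlloc : ℕ → ℕ → ℕ → ℕ → Proc
FrontAlloc i b c e =
  alloc 2 (Front i b ∥ snd (ch b) (vr 2 ∷ []) nil ∥ snd (ch c) (ch e ∷ vr 2 ∷ []) nil)

Link : ℕ → ℕ → Proc
Link b c = snd (ch b) (ch c ∷ []) nil

Cell : ℕ → ℕ → ℕ → Proc
Cell c e c′ = snd (ch c) (ch e ∷ ch c′ ∷ []) nil

Back : ℕ → ℕ → Proc
Back o d = rec 3 (rcv (ch d) (0 ∷ []) (rcv (vr 0) (1 ∷ 2 ∷ [])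
  (snd (ch o) (vr 1 ∷ []) (pvar 3 ∥ snd (ch d) (vr 2 ∷ []) nil))))

Backᵘ : ℕ → ℕ → Proc
Backᵘ o d = rcv (ch d) (0 ∷ []) (rcv (vr 0) (1 ∷ 2 ∷ [])
  (snd (ch o) (vr 1 ∷ []) (Back o d ∥ snd (ch d) (vr 2 ∷ []) nil)))

BackIn : ℕ → ℕ → ℕ → Proc
BackIn o d c = rcv (ch c) (1 ∷ 2 ∷ []) (snd (ch o) (vr 1 ∷ []) (Back o d ∥ snd (ch d) (vr 2 ∷ []) nil))

BackOut : ℕ → ℕ → ℕ → ℕ → Proc
BackOut o d e c′ = snd (ch o) (ch e ∷ []) (Back o d ∥ Link d c′)

-- The side conditions b ≢ o and d ≢ o make sure that passing on a link weighs nothing.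
data Shape (o : ℕ) : Proc → Set where
  par        : ∀ {P Q} → Shape o P → Shape o Q → Shape o (P ∥ Q)
  nil        : Shape o nil
  frontRec   : ∀ {i b} → b ≢ o → Shape o (Front i b)
  frontᵘ     : ∀ {i b} → b ≢ o → Shape o (Frontᵘ i b)
  frontIn    : ∀ {i b c} → b ≢ o → Shape o (FrontIn i b c)
  frontAlloc : ∀ {i b c e} → b ≢ o → Shape o (FrontAlloc i b c e)
  link       : ∀ {b c} → b ≢ o → Shape o (Link b c)
  cell       : ∀ {c e c′} → Shape o (Cell c e c′)
  backRec    : ∀ {o′ d} → d ≢ o → Shape o (Back o′ d)
  backᵘ      : ∀ {o′ d} → d ≢ o → Shape o (Backᵘ o′ d)
  backIn     : ∀ {o′ d c} → d ≢ o → Shape o (BackIn o′ d c)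
  backOut    : ∀ {o′ d e c′} → d ≢ o → Shape o (BackOut o′ d e c′)

-- Each datum in transit holds one prepaid allocation.
potential : ∀ {o P} → Shape o P → ℕ
potential (par s t) = potential s ℕ.+ potential t
potential cell = 1
potential (backOut _) = 1
potential _ = 0

pairCount : List ℕ → ℕ
pairCount (_ ∷ _ ∷ []) = 1
pairCount _ = 0

sentCount : ℕ → ℕ → List ℕ → ℕ
sentCount o c ds = if does (c ≟ o) then 1 else pairCount ds

-- Chosen so that every move of Buff meets Pre-bound: an output on o or of a pair passes a datum
-- on, a pair input takes one up, and environment allocations and frees are settled by their cost.
weight : ℕ → Label → ℤ
weight o (outL c ds) = - + sentCount o c ds
weight o (inL c ds) = + pairCount ds
weight o tau = 0ℤ
weight o allocL = -1ℤ
weight o (freeL _) = 1ℤ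
weight o envL = 0ℤ

weight-link : ∀ {o b} c → b ≢ o → weight o (outL b (c ∷ [])) ≡ 0ℤ
weight-link {o} {b} c b≢o rewrite dec-false (b ≟ o) b≢o = refl

weight-self : ∀ o ds → weight o (outL o ds) ≡ - + 1
weight-self o ds rewrite dec-true (o ≟ o) refl = refl

pairCount≤1 : ∀ ds → pairCount ds ℕ.≤ 1
pairCount≤1 (_ ∷ _ ∷ []) = s≤s z≤n
pairCount≤1 [] = z≤n
pairCount≤1 (_ ∷ []) = z≤n
pairCount≤1 (_ ∷ _ ∷ _ ∷ _) = z≤n

pairCount≤sentCount : ∀ o c ds → pairCount ds ℕ.≤ sentCount o c ds
pairCount≤sentCount o c ds with does (c ≟ o)
... | true = pairCount≤1 ds
... | false = ℕ.≤-refl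

-1≤weight-out : ∀ o c ds → -1ℤ ≤ weight o (outL c ds)
-1≤weight-out o c ds with does (c ≟ o)
... | true = -≤- z≤n
... | false = ℤ.neg-mono-≤ (+≤+ (pairCount≤1 ds))

record Within (o φ : ℕ) (δ : ℤ) (P : Proc) : Set where
  constructor _,_
  field
    shape : Shape o P
    bound : + potential shape ≤ + φ + δ

-- Potential bounds for the moves of Buff

module _ where
  open ℤ.≤-Reasoning

  ≤-+-trans : ∀ x {y z} δ η → y ≤ x + δ → z ≤ y + η → z ≤ x + (δ + η)
  ≤-+-trans x {y} {z} δ η y≤ z≤ = begin
    z            ≤⟨ z≤ ⟩
    y + η        ≤⟨ ℤ.+-monoˡ-≤ η y≤ ⟩
    x + δ + η    ≡⟨ ℤ.+-assoc x δ η ⟩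
    x + (δ + η)  ∎

  ≤-+-frameʳ : ∀ {x′} x y δ → x′ ≤ x + δ → x′ + y ≤ (x + y) + δ
  ≤-+-frameʳ {x′} x y δ le = begin
    x′ + y        ≤⟨ ℤ.+-monoˡ-≤ y le ⟩
    x + δ + y     ≡⟨ solve (x ∷ δ ∷ y ∷ []) ⟩
    (x + y) + δ   ∎

  ≤-+-frameˡ : ∀ {y′} x y δ → y′ ≤ y + δ → x + y′ ≤ (x + y) + δ
  ≤-+-frameˡ {y′} x y δ le = begin
    x + y′        ≤⟨ ℤ.+-monoʳ-≤ x le ⟩
    x + (y + δ)   ≡⟨ solve (x ∷ y ∷ δ ∷ []) ⟩
    (x + y) + δ   ∎

  ≤-+-merge : ∀ {x′ y′} x y w v → x′ ≤ x + (0ℤ + w) → y′ ≤ y + (0ℤ + v) → w + v ≤ 0ℤ →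
              x′ + y′ ≤ (x + y) + 0ℤ
  ≤-+-merge {x′} {y′} x y w v x≤ y≤ w+v≤0 = begin
    x′ + y′                      ≤⟨ ℤ.+-mono-≤ x≤ y≤ ⟩
    x + (0ℤ + w) + (y + (0ℤ + v)) ≡⟨ solve (x ∷ y ∷ w ∷ v ∷ []) ⟩
    (x + y) + (w + v)            ≤⟨ ℤ.+-monoʳ-≤ (x + y) w+v≤0 ⟩
    (x + y) + 0ℤ                 ∎

pos-+-≤ : ∀ a b c d δ → + a + + b ≤ (+ c + + d) + δ → + (a ℕ.+ b) ≤ + (c ℕ.+ d) + δ
pos-+-≤ a b c d δ le rewrite ℤ.pos-+ a b | ℤ.pos-+ c d = le

within-parˡ : ∀ {o φ δ P Q} (t : Shape o Q) → Within o φ δ P → Within o (φ ℕ.+ potential t) δ (P ∥ Q)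
within-parˡ {φ = φ} {δ} t (s , le) =
  par s t , pos-+-≤ (potential s) (potential t) φ (potential t) δ (≤-+-frameʳ (+ φ) (+ potential t) δ le)

within-parʳ : ∀ {o φ δ P Q} (s : Shape o P) → Within o φ δ Q → Within o (potential s ℕ.+ φ) δ (P ∥ Q)
within-parʳ {φ = φ} {δ} s (t , le) =
  par s t , pos-+-≤ (potential s) (potential t) (potential s) φ δ (≤-+-frameˡ (+ potential s) (+ φ) δ le)

within-comm : ∀ {o φ ψ P Q} w v → Within o φ (0ℤ + w) P → Within o ψ (0ℤ + v) Q → w + v ≤ 0ℤ →
              Within o (φ ℕ.+ ψ) 0ℤ (P ∥ Q)
within-comm {φ = φ} {ψ} w v (s , s≤) (t , t≤) w+v≤0 =
  par s t , pos-+-≤ (potential s) (potential t) φ ψ 0ℤ (≤-+-merge (+ φ) (+ ψ) w v s≤ t≤ w+v≤0)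

within-idle : ∀ {o P} (s : Shape o P) → Within o (potential s) 0ℤ P
within-idle s = s , ℤ.≤-reflexive (sym (ℤ.+-identityʳ _))

weight-out+in≤0 : ∀ o c ds → weight o (outL c ds) + weight o (inL c ds) ≤ 0ℤ
weight-out+in≤0 o c ds = subst (_≤ 0ℤ) (sym out+in≡-[sent∸pairs]) ℤ.neg-≤-pos
  where
  out+in≡-[sent∸pairs] : weight o (outL c ds) + weight o (inL c ds) ≡ - + (sentCount o c ds ℕ.∸ pairCount ds)
  out+in≡-[sent∸pairs] = trans (ℤ.-m+n≡n⊖m (sentCount o c ds) (pairCount ds)) (ℤ.⊖-≤ (pairCount≤sentCount o c ds))

-- Emitting a datum may spend the one unit of potential it holds.
emit-bound : ∀ o c ds → + 0 ≤ + 1 + (0ℤ + weight o (outL c ds))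
emit-bound o c ds rewrite ℤ.+-identityˡ (weight o (outL c ds)) = ℤ.+-monoʳ-≤ (+ 1) (-1≤weight-out o c ds)

Pre-bound : ∀ {o Γ M P μ k Γ′ S′} → Pre Γ (M ▷ P) μ k Γ′ S′ → (s : Shape o P) →
             Within o (potential s) (k + weight o μ) (prc S′)
Pre-bound (p-out {ds = c ∷ []} _ _ _ _) (link b≢o) rewrite weight-link c b≢o = nil , ℤ.≤-refl
Pre-bound {o} (p-out {c = c} {ds = ds@(_ ∷ [])} _ _ _ _) (backOut d≢o) = par (backRec d≢o) (link d≢o) , emit-bound o c ds
Pre-bound {o} (p-out {c = c} {ds = ds@(_ ∷ _ ∷ [])} _ _ _ _) cell = nil , emit-bound o c ds
Pre-bound (p-out {ds = []} _ _ _ _) ()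
Pre-bound (p-out {ds = _ ∷ _ ∷ _ ∷ _} _ _ _ _) ()
Pre-bound (p-in {ds = _ ∷ []} _ _ _ _ _) (frontᵘ b≢o) = frontIn b≢o , ℤ.≤-refl
Pre-bound (p-in {ds = _ ∷ []} _ _ _ _ _) (frontIn b≢o) = frontAlloc b≢o , ℤ.≤-refl
Pre-bound (p-in {ds = _ ∷ []} _ _ _ _ _) (backᵘ d≢o) = backIn d≢o , ℤ.≤-refl
Pre-bound (p-in {ds = _ ∷ _ ∷ []} _ _ _ _ _) (backIn d≢o) = backOut d≢o , ℤ.≤-refl
Pre-bound (p-in {ds = []} _ _ _ () _) (frontᵘ _)
Pre-bound (p-in {ds = _ ∷ _ ∷ _} _ _ _ () _) (frontᵘ _)
Pre-bound (p-in {ds = []} _ _ _ () _) (frontIn _)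
Pre-bound (p-in {ds = _ ∷ _ ∷ _} _ _ _ () _) (frontIn _)
Pre-bound (p-in {ds = []} _ _ _ () _) (backᵘ _)
Pre-bound (p-in {ds = _ ∷ _ ∷ _} _ _ _ () _) (backᵘ _)
Pre-bound (p-in {ds = []} _ _ _ () _) (backIn _)
Pre-bound (p-in {ds = _ ∷ []} _ _ _ () _) (backIn _)
Pre-bound (p-in {ds = _ ∷ _ ∷ _ ∷ _} _ _ _ () _) (backIn _)
Pre-bound {o} (p-comL {c = c} {ds} out inp) (par s t) =
  within-comm (weight o (outL c ds)) (weight o (inL c ds)) (Pre-bound out s) (Pre-bound inp t)
    (weight-out+in≤0 o c ds)
Pre-bound {o} (p-comR {c = c} {ds} inp out) (par s t) =
  within-comm (weight o (inL c ds)) (weight o (outL c ds)) (Pre-bound inp s) (Pre-bound out t)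
    (subst (_≤ 0ℤ) (ℤ.+-comm (weight o (outL c ds)) (weight o (inL c ds))) (weight-out+in≤0 o c ds))
Pre-bound (p-parL p) (par s t) = within-parˡ t (Pre-bound p s)
Pre-bound (p-parR p) (par s t) = within-parʳ s (Pre-bound p t)
Pre-bound (p-env _) s = within-idle s
Pre-bound (p-allocE _ _ _) s = within-idle s
Pre-bound (p-freeE _ _ _) s = within-idle s
Pre-bound p-rec (frontRec b≢o) = frontᵘ b≢o , ℤ.≤-refl
Pre-bound p-rec (backRec d≢o) = backᵘ d≢o , ℤ.≤-refl
Pre-bound (p-alloc _) (frontAlloc b≢o) = par (frontRec b≢o) (par (link b≢o) cell) , ℤ.≤-refl

within-trans : ∀ {o φ δ η P Q} → Within o φ δ P → ((s : Shape o P) → Within o (potential s) η Q) →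
               Within o φ (δ + η) Q
within-trans {φ = φ} {δ} {η} (s , s≤) next with next s
... | t , t≤ = t , ≤-+-trans (+ φ) δ η s≤ t≤

within-cong : ∀ {o φ δ η P} → δ ≡ η → Within o φ δ P → Within o φ η P
within-cong refl w = w

Shape-renP : ∀ {o P} (h : ℕ → ℕ) → (∀ x → h x ≡ o → x ≡ o) → (s : Shape o P) →
               Σ (Shape o (renP h P)) λ s′ → potential s′ ≡ potential s
Shape-renP h refl-o (par s t) with Shape-renP h refl-o s | Shape-renP h refl-o t
... | s′ , eq | t′ , eq′ = par s′ t′ , cong₂ ℕ._+_ eq eq′
Shape-renP h refl-o nil = nil , refl
Shape-renP h refl-o (frontRec {b = b} b≢o) = frontRec (b≢o ∘ refl-o b) , refl
Shape-renP h refl-o (frontᵘ {b = b} b≢o) = frontᵘ (b≢o ∘ refl-o b) , refl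
Shape-renP h refl-o (frontIn {b = b} b≢o) = frontIn (b≢o ∘ refl-o b) , refl
Shape-renP h refl-o (frontAlloc {b = b} b≢o) = frontAlloc (b≢o ∘ refl-o b) , refl
Shape-renP h refl-o (link {b = b} b≢o) = link (b≢o ∘ refl-o b) , refl
Shape-renP h refl-o cell = cell , refl
Shape-renP h refl-o (backRec {d = d} d≢o) = backRec (d≢o ∘ refl-o d) , refl
Shape-renP h refl-o (backᵘ {d = d} d≢o) = backᵘ (d≢o ∘ refl-o d) , refl
Shape-renP h refl-o (backIn {d = d} d≢o) = backIn (d≢o ∘ refl-o d) , refl
Shape-renP h refl-o (backOut {d = d} d≢o) = backOut (d≢o ∘ refl-o d) , refl

Trans-bound : ∀ {o Γ S μ k Γ′ S′} → ch o ∈ dom Γ → Trans Γ S μ k Γ′ S′ → (s : Shape o (prc S)) →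
              Within o (potential s) (k + weight o μ) (prc S′)
Trans-bound {o} o∈Γ (σ , fixes , p) s with Shape-renP (f σ) reflects s
  where
  reflects : ∀ x → f σ x ≡ o → x ≡ o
  reflects x fx≡o = begin
    x             ≡⟨ gf σ x ⟨
    g σ (f σ x)   ≡⟨ cong (g σ) (trans fx≡o (sym (fixes o o∈Γ))) ⟩
    g σ (f σ o)   ≡⟨ gf σ o ⟩
    o             ∎
    where open ≡-Reasoning
... | s′ , eq = subst (λ φ → Within o φ _ _) eq (Pre-bound p s′)

Pre-τ-env : ∀ {Γ S k Γ′ S′} → Pre Γ S tau k Γ′ S′ → Γ ≡ Γ′
Pre-τ-env (p-comL _ _) = refl
Pre-τ-env (p-comR _ _) = refl
Pre-τ-env (p-parL p) = Pre-τ-env p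
Pre-τ-env (p-parR p) = Pre-τ-env p
Pre-τ-env p-rec = refl
Pre-τ-env (p-then _) = refl
Pre-τ-env (p-else _ _ _) = refl
Pre-τ-env (p-alloc _) = refl
Pre-τ-env (p-free _) = refl

Taus-env : ∀ {Γ S k Γ′ S′} → Taus Γ S k Γ′ S′ → Γ ≡ Γ′
Taus-env none = refl
Taus-env (more (_ , _ , p) ts) = trans (Pre-τ-env p) (Taus-env ts)

Taus-bound : ∀ {o Γ S k Γ′ S′} → ch o ∈ dom Γ → Taus Γ S k Γ′ S′ → (s : Shape o (prc S)) →
             Within o (potential s) k (prc S′)
Taus-bound o∈Γ none s = within-idle s
Taus-bound {o} {S = S} o∈Γ (more {S₁ = S₁} {k = k} t@(_ , _ , p) ts) s =
  within-trans (within-cong (ℤ.+-identityʳ k) (Trans-bound {S = S} {S′ = S₁} o∈Γ t s))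
               (Taus-bound (subst (λ Δ → ch o ∈ dom Δ) (Pre-τ-env p) o∈Γ) ts)

Weak-bound : ∀ {o Γ S μ k Γ′ S′} → ch o ∈ dom Γ → ch o ∈ dom Γ′ → Weak Γ S μ k Γ′ S′ →
             (s : Shape o (prc S)) → Within o (potential s) (k + weight o μ) (prc S′)
Weak-bound {o} {μ = μ} o∈Γ o∈Γ′ (Γ₁ , S₁ , Γ₂ , S₂ , k₁ , k₂ , k₃ , before , t , after , refl) s =
  within-cong (regroup k₁ k₂ k₃ (weight o μ))
    (within-trans (within-trans (Taus-bound o∈Γ before s) (Trans-bound {S = S₁} {S′ = S₂} o∈Γ₁ t))
                  (Taus-bound o∈Γ₂ after))
  where
  o∈Γ₁ : ch o ∈ dom Γ₁
  o∈Γ₁ = subst (λ Δ → ch o ∈ dom Δ) (Taus-env before) o∈Γ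
  o∈Γ₂ : ch o ∈ dom Γ₂
  o∈Γ₂ = subst (λ Δ → ch o ∈ dom Δ) (sym (Taus-env after)) o∈Γ′
  regroup : ∀ k₁ k₂ k₃ w → k₁ + (k₂ + w) + k₃ ≡ k₁ + k₂ + k₃ + w
  regroup = solve-∀

WeakHat-bound : ∀ {o Γ S k Γ′ S′} μ → ch o ∈ dom Γ → ch o ∈ dom Γ′ → WeakHat Γ S μ k Γ′ S′ →
                (s : Shape o (prc S)) → Within o (potential s) (k + weight o μ) (prc S′)
WeakHat-bound tau o∈Γ _ ts s = within-cong (sym (ℤ.+-identityʳ _)) (Taus-bound o∈Γ ts s)
WeakHat-bound (outL _ _) = Weak-bound
WeakHat-bound (inL _ _) = Weak-bound
WeakHat-bound allocL = Weak-bound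
WeakHat-bound (freeL _) = Weak-bound
WeakHat-bound envL = Weak-bound

-- Answering a run of eBuff

record Reply (R : Rel) (o : ℕ) (Γ : Env) (m : ℕ) (δ : ℤ) (T : Sys) : Set₁ where
  constructor reply
  field
    {credit} : ℕ
    {left}   : Sys
    related  : R Γ credit left T
    shape    : Shape o (prc left)
    bound    : + (credit ℕ.+ potential shape) ≤ + m + δ

credit-bound : ∀ n′ n φ′ φ l k w → + n′ ≡ + n + l - k → + φ′ ≤ + φ + (k + w) →
               + (n′ ℕ.+ φ′) ≤ + (n ℕ.+ φ) + (l + w)
credit-bound n′ n φ′ φ l k w n′≡ φ′≤ = begin
  + (n′ ℕ.+ φ′)                   ≡⟨ ℤ.pos-+ n′ φ′ ⟩
  + n′ + + φ′                     ≤⟨ ℤ.+-monoʳ-≤ (+ n′) φ′≤ ⟩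
  + n′ + (+ φ + (k + w))          ≡⟨ cong (_+ (+ φ + (k + w))) n′≡ ⟩
  + n + l - k + (+ φ + (k + w))   ≡⟨ regroup (+ n) (+ φ) l k w ⟩
  + n + + φ + (l + w)             ≡⟨ cong (_+ (l + w)) (ℤ.pos-+ n φ) ⟨
  + (n ℕ.+ φ) + (l + w)           ∎
  where
  open ℤ.≤-Reasoning
  regroup : ∀ a b l k w → a + l - k + (b + (k + w)) ≡ a + b + (l + w)
  regroup = solve-∀

data Run (o : ℕ) : Env → Sys → ℤ → Env → Sys → Set₁ where
  done : ∀ {Γ T} → Run o Γ T 0ℤ Γ T
  move : ∀ {Γ T μ l Γ₁ T₁ δ Γ₂ T₂} → ch o ∈ dom Γ → ch o ∈ dom Γ₁ → Trans Γ T μ l Γ₁ T₁ →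
         Run o Γ₁ T₁ δ Γ₂ T₂ → Run o Γ T (l + weight o μ + δ) Γ₂ T₂

Run-cast : ∀ {o Γ T δ η Γ′ T′} → δ ≡ η → Run o Γ T δ Γ′ T′ → Run o Γ T η Γ′ T′
Run-cast refl run = run

module _ {R : Rel} (isB : IsBisim R) where

  answer : ∀ {o Γ n S T μ l Γ′ T′} → ch o ∈ dom Γ → ch o ∈ dom Γ′ → R Γ n S T → (s : Shape o (prc S)) →
           Trans Γ T μ l Γ′ T′ → Reply R o Γ′ (n ℕ.+ potential s) (l + weight o μ) T′
  answer {o} {n = n} {μ = μ} {l} o∈Γ o∈Γ′ r s t with proj₂ (proj₂ (proj₂ (isB r))) μ l _ _ t
  ... | k , S′ , n′ , match , n′≡ , r′ with WeakHat-bound μ o∈Γ o∈Γ′ match s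
  ... | s′ , s′≤ = reply r′ s′ (credit-bound n′ n (potential s′) (potential s) l k (weight o μ) n′≡ s′≤)

  answer* : ∀ {o Γ n S T δ Γ′ T′} → R Γ n S T → (s : Shape o (prc S)) → Run o Γ T δ Γ′ T′ →
            Reply R o Γ′ (n ℕ.+ potential s) δ T′
  answer* r s done = reply r s (ℤ.≤-reflexive (sym (ℤ.+-identityʳ _)))
  answer* {o} {n = n} r s (move {μ = μ} {l} {δ = δ} o∈Γ o∈Γ₁ t run) with answer o∈Γ o∈Γ₁ r s t
  ... | reply r₁ s₁ b₁ with answer* r₁ s₁ run
  ... | reply r₂ s₂ b₂ = reply r₂ s₂ (≤-+-trans (+ (n ℕ.+ potential s)) (l + weight o μ) δ b₁ b₂)

data Ctx : Set where
  hole : Ctx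
  _◂_  : Ctx → Proc → Ctx

plug : Ctx → Proc → Proc
plug hole P = P
plug (C ◂ Q) P = plug C (P ∥ Q)

Pre-plug : ∀ C {Γ M P μ k Γ′ M′ P′} → Pre Γ (M ▷ P) μ k Γ′ (M′ ▷ P′) →
           Pre Γ (M ▷ plug C P) μ k Γ′ (M′ ▷ plug C P′)
Pre-plug hole p = p
Pre-plug (C ◂ Q) p = Pre-plug C (p-parL p)

renId-id : ∀ u → renId id u ≡ u
renId-id (ch _) = refl
renId-id (vr _) = refl

renP-id : ∀ P → renP id P ≡ P
renP-id (snd u vs P)
  rewrite renId-id u | map-id-local {xs = vs} (All.tabulate λ {v} _ → renId-id v) | renP-id P = refl
renP-id (rcv u xs P) rewrite renId-id u | renP-id P = refl
renP-id nil = refl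
renP-id (ite u v P Q) rewrite renId-id u | renId-id v | renP-id P | renP-id Q = refl
renP-id (rec w P) rewrite renP-id P = refl
renP-id (pvar w) = refl
renP-id (P ∥ Q) rewrite renP-id P | renP-id Q = refl
renP-id (alloc x P) rewrite renP-id P = refl
renP-id (free u P) rewrite renId-id u | renP-id P = refl

identityBij : Bij
identityBij = record { f = id ; g = id ; fg = λ _ → refl ; gf = λ _ → refl }

Pre⇒Trans : ∀ {Γ M P μ l Γ′ T′} → Pre Γ (M ▷ P) μ l Γ′ T′ → Trans Γ (M ▷ P) μ l Γ′ T′
Pre⇒Trans {Γ} {M} {P} {μ} {l} {Γ′} {T′} p =
  identityBij , (λ _ _ → refl) , subst (λ Q → Pre Γ (M ▷ Q) μ l Γ′ T′) (sym (renP-id P)) p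

bul0⊑ : ∀ a → bul 0 ⊑ a
bul0⊑ ω = ⊑-bω
bul0⊑ one = ⊑-trans ⊑-bω ⊑-ω1
bul0⊑ (bul zero) = ⊑-refl
bul0⊑ (bul (suc i)) = ⊑-trans (bul0⊑ (bul i)) ⊑-bb

InfFree-addR : ∀ {M c} → InfFree M → InfFree (addR M c)
InfFree-addR {M} {c} inf k with inf (k ℕ.+ suc c)
... | x , k+1+c≤x , x∉M = x , ℕ.≤-trans (ℕ.m≤m+n k (suc c)) k+1+c≤x , λ where
  (inj₁ x∈M) → x∉M x∈M
  (inj₂ refl) → ℕ.1+n≰n (ℕ.≤-trans (ℕ.m≤n+m (suc c) k) k+1+c≤x)

InfFree-delR : ∀ {M c} → InfFree M → InfFree (delR M c)
InfFree-delR inf k with inf k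
... | x , k≤x , x∉M = x , k≤x , x∉M ∘ proj₁

-- The game against eBuff

module BufferGame (T : Ty) (vT : ValidT T) (inc outc b d e : ℕ) {R : Rel} (isB : IsBisim R) where

  open import Data.List.Relation.Unary.All using ([]; _∷_)

  C : Ty
  C = chan (T ∷ []) ω

  -- The communication rules accept any typing of the two partners; cells and links use Name.
  Name : Ty
  Name = chan [] ω

  ⊢Name : ValidT Name
  ⊢Name = ValidT-chan⁺ []

  ⊢C : ValidT C
  ⊢C = ValidT-chan⁺ (vT ∷ [])

  ⊢link : ValidT (chan (Name ∷ []) ω)
  ⊢link = ValidT-chan⁺ (⊢Name ∷ [])

  ⊢cell : ValidT (chan (Name ∷ Name ∷ []) ω)
  ⊢cell = ValidT-chan⁺ (⊢Name ∷ ⊢Name ∷ [])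

  Γ⁺ : Env
  Γ⁺ = (ch outc , ty C) ∷ (ch e , ty T) ∷ (ch inc , ty C) ∷ []

  outc∈Γ⁺ : ch outc ∈ dom Γ⁺
  outc∈Γ⁺ = here refl

  outc∈Γ : ch outc ∈ dom (Γext T inc outc)
  outc∈Γ = there (here refl)

  eBack : Proc
  eBack = eBk inc outc b d e

  eBackᵘ : Proc
  eBackᵘ = rcv (ch d) (0 ∷ []) (rcv (vr 0) (1 ∷ 2 ∷ []) (free (vr 0)
    (snd (ch outc) (vr 1 ∷ []) (eBack ∥ snd (ch d) (vr 2 ∷ []) nil))))

  eBackIn : ℕ → Proc
  eBackIn c = rcv (ch c) (1 ∷ 2 ∷ []) (free (ch c)
    (snd (ch outc) (vr 1 ∷ []) (eBack ∥ snd (ch d) (vr 2 ∷ []) nil)))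

  -- eBuff after some rounds, with its garbage 0's kept in the contexts and c the next cell.
  eBuffer : Ctx → Ctx → ℕ → Proc
  eBuffer CF CB c = plug CF (FrontIn inc b c) ∥ plug CB (eBackIn c)

  receive : ∀ CF CB c M →
    Pre Γ⁺ (M ▷ eBuffer CF CB c) (inL inc (e ∷ [])) 0ℤ (Γext T inc outc)
        (M ▷ (plug CF (FrontAlloc inc b c e) ∥ plug CB (eBackIn c)))
  receive CF CB c M = p-parL (Pre-plug CF (p-in {Γ₀ = (ch outc , ty C) ∷ []} {xs = 1 ∷ []} {Ts = T ∷ []} {a = ω}
    (≈E-↭ (⊢C ∷ vT ∷ ⊢C ∷ []) (↭-trans (swap _ _ ↭-refl) (↭-trans (prep _ (swap _ _ ↭-refl)) (swap _ _ ↭-refl))))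
    refl refl refl (≈E-refl (⊢C ∷ ⊢C ∷ []))))

  allocate : ∀ CF CB c M c′ → ¬ M c′ →
    Pre (Γext T inc outc) (M ▷ (plug CF (FrontAlloc inc b c e) ∥ plug CB (eBackIn c))) tau 1ℤ (Γext T inc outc)
        (addR M c′ ▷ (plug CF (Front inc b ∥ Link b c′ ∥ Cell c e c′) ∥ plug CB (eBackIn c)))
  allocate CF CB c M c′ c′∉M = p-parL (Pre-plug CF (p-alloc c′∉M))

  send-cell : ∀ CF CB c M c′ →
    Pre (Γext T inc outc) (M ▷ (plug CF (Front inc b ∥ Link b c′ ∥ Cell c e c′) ∥ plug CB (eBackIn c))) tau 0ℤ
        (Γext T inc outc)
        (M ▷ (plug CF (Front inc b ∥ Link b c′ ∥ nil) ∥
              plug CB (free (ch c) (snd (ch outc) (ch e ∷ []) (eBack ∥ Link d c′)))))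
  send-cell CF CB c M c′ = p-comL
    (Pre-plug CF (p-parR (p-parR (p-out {Γ₀ = []} {ds = e ∷ c′ ∷ []} {Ts = Name ∷ Name ∷ []} {a = ω}
      (≈E-refl (⊢cell ∷ [])) refl refl (≈E-refl (⊢cell ∷ ⊢Name ∷ ⊢Name ∷ []))))))
    (Pre-plug CB (p-in {Γ₀ = []} {ds = e ∷ c′ ∷ []} {xs = 1 ∷ 2 ∷ []} {Ts = Name ∷ Name ∷ []} {a = ω}
      (≈E-refl (⊢cell ∷ ⊢Name ∷ ⊢Name ∷ [])) refl refl refl (≈E-refl (⊢cell ∷ []))))

  free-cell : ∀ CF CB c M P Q → M c →
    Pre (Γext T inc outc) (M ▷ (plug CF P ∥ plug CB (free (ch c) Q))) tau -1ℤ (Γext T inc outc)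
        (delR M c ▷ (plug CF P ∥ plug CB Q))
  free-cell CF CB c M P Q c∈M = p-parR (Pre-plug CB (p-free c∈M))

  emit : ∀ CF CB M P Q →
    Pre (Γext T inc outc) (M ▷ (plug CF P ∥ plug CB (snd (ch outc) (ch e ∷ []) Q))) (outL outc (e ∷ [])) 0ℤ Γ⁺
        (M ▷ (plug CF P ∥ plug CB Q))
  emit CF CB M P Q = p-parR (Pre-plug CB (p-out {Γ₀ = (ch inc , ty C) ∷ []} {ds = e ∷ []} {Ts = T ∷ []} {a = ω}
    (≈E-↭ (⊢C ∷ ⊢C ∷ []) (swap _ _ ↭-refl)) refl refl (≈E-refl (⊢C ∷ vT ∷ ⊢C ∷ []))))

  unfold-front : ∀ CF M P Q →
    Pre Γ⁺ (M ▷ (plug CF (Front inc b ∥ P) ∥ Q)) tau 0ℤ Γ⁺ (M ▷ (plug CF (Frontᵘ inc b ∥ P) ∥ Q))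
  unfold-front CF M P Q = p-parL (Pre-plug CF (p-parL p-rec))

  pass-link-front : ∀ CF M c′ Q →
    Pre Γ⁺ (M ▷ (plug CF (Frontᵘ inc b ∥ (Link b c′ ∥ nil)) ∥ Q)) tau 0ℤ Γ⁺
        (M ▷ (plug CF (FrontIn inc b c′ ∥ (nil ∥ nil)) ∥ Q))
  pass-link-front CF M c′ Q = p-parL (Pre-plug CF (p-comR
    (p-in {Γ₀ = []} {ds = c′ ∷ []} {xs = 0 ∷ []} {Ts = Name ∷ []} {a = ω}
      (≈E-refl (⊢link ∷ ⊢Name ∷ [])) refl refl refl (≈E-refl (⊢link ∷ [])))
    (p-parL (p-out {Γ₀ = []} {ds = c′ ∷ []} {Ts = Name ∷ []} {a = ω}
      (≈E-refl (⊢link ∷ [])) refl refl (≈E-refl (⊢link ∷ ⊢Name ∷ []))))))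

  unfold-back : ∀ CB M P Q →
    Pre Γ⁺ (M ▷ (P ∥ plug CB (eBack ∥ Q))) tau 0ℤ Γ⁺ (M ▷ (P ∥ plug CB (eBackᵘ ∥ Q)))
  unfold-back CB M P Q = p-parR (Pre-plug CB (p-parL p-rec))

  pass-link-back : ∀ CB M P c′ →
    Pre Γ⁺ (M ▷ (P ∥ plug CB (eBackᵘ ∥ Link d c′))) tau 0ℤ Γ⁺ (M ▷ (P ∥ plug CB (eBackIn c′ ∥ nil)))
  pass-link-back CB M P c′ = p-parR (Pre-plug CB (p-comR
    (p-in {Γ₀ = []} {ds = c′ ∷ []} {xs = 0 ∷ []} {Ts = Name ∷ []} {a = ω}
      (≈E-refl (⊢link ∷ ⊢Name ∷ [])) refl refl refl (≈E-refl (⊢link ∷ [])))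
    (p-out {Γ₀ = []} {ds = c′ ∷ []} {Ts = Name ∷ []} {a = ω}
      (≈E-refl (⊢link ∷ [])) refl refl (≈E-refl (⊢link ∷ ⊢Name ∷ [])))))

  -- The costs of a round cancel, but its output on outc has weight -1.
  round : ∀ CF CB c M c′ → M c → ¬ M c′ →
    Run outc Γ⁺ (M ▷ eBuffer CF CB c) -1ℤ Γ⁺ (delR (addR M c′) c ▷ eBuffer (CF ◂ (nil ∥ nil)) (CB ◂ nil) c′)
  round CF CB c M c′ c∈M c′∉M =
    move outc∈Γ⁺ outc∈Γ (Pre⇒Trans (receive CF CB c M)) (
    move outc∈Γ outc∈Γ (Pre⇒Trans (allocate CF CB c M c′ c′∉M)) (
    move outc∈Γ outc∈Γ (Pre⇒Trans (send-cell CF CB c (addR M c′) c′)) (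
    move outc∈Γ outc∈Γ (Pre⇒Trans (free-cell CF CB c (addR M c′) _ _ (inj₁ c∈M))) (
    Run-cast (cong (λ w → 0ℤ + w + 0ℤ) (weight-self outc (e ∷ []))) (
    move outc∈Γ outc∈Γ⁺ (Pre⇒Trans (emit CF CB M′ _ _)) (
    move outc∈Γ⁺ outc∈Γ⁺ (Pre⇒Trans (unfold-front CF M′ _ _)) (
    move outc∈Γ⁺ outc∈Γ⁺ (Pre⇒Trans (pass-link-front CF M′ c′ _)) (
    move outc∈Γ⁺ outc∈Γ⁺ (Pre⇒Trans (unfold-back CB M′ _ _)) (
    move outc∈Γ⁺ outc∈Γ⁺ (Pre⇒Trans (pass-link-back CB M′ _ c′))
    done)))))))))
    where
    M′ : ℕ → Set
    M′ = delR (addR M c′) c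

  -- The right side first creates the datum e it will feed through the buffer forever.
  opening : ∀ c₁ M → ¬ M e →
    Run outc (Γext T inc outc) (M ▷ eBuff inc outc b d c₁) 0ℤ Γ⁺ (addR M e ▷ eBuff inc outc b d c₁)
  opening c₁ M e∉M with ValidT⇒Unf vT
  ... | Us , a , T↠Us , ⊢Us =
    move outc∈Γ (there (there (here refl))) (Pre⇒Trans (p-allocE e∉M ⊢Us• (≈E-refl (⊢Us• ∷ ⊢C ∷ ⊢C ∷ [])))) (
    move (there (there (here refl))) outc∈Γ⁺
      (Pre⇒Trans (p-env (subty (sub (bul0⊑ a)) ◅ equiv (ty∼ (Unf⇒∼T ⊢Us T↠Us)) vT ◅
                         perm (↭-trans (prep _ (swap _ _ ↭-refl)) (swap _ _ ↭-refl)) ◅ ε)))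
    done)
    where
    ⊢Us• : ValidT (chan Us (bul 0))
    ⊢Us• = ValidT-chan⁺ (ValidT-chan⁻ ⊢Us)

  record Position : Set₁ where
    field
      {credit} : ℕ
      {left}   : Sys
      shape    : Shape outc (prc left)
      CF CB    : Ctx
      c        : ℕ
      M        : ℕ → Set
      c∈M      : M c
      infFree  : InfFree M
      related  : R Γ⁺ credit left (M ▷ eBuffer CF CB c)

  measure : Position → ℕ
  measure p = credit ℕ.+ potential shape
    where open Position p

  descend : (p : Position) → Σ Position λ p′ → measure p′ ℕ.< measure p
  descend p = p′ , below (measure p′) (measure p) (Reply.bound r)
    where
    open Position p
    c′ : ℕ
    c′ = proj₁ (infFree 0)
    c′∉M : ¬ M c′
    c′∉M = proj₂ (proj₂ (infFree 0))
    r : Reply R outc Γ⁺ (measure p) -1ℤ (delR (addR M c′) c ▷ eBuffer (CF ◂ (nil ∥ nil)) (CB ◂ nil) c′)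
    r = answer* isB related shape (round CF CB c M c′ c∈M c′∉M)
    p′ : Position
    p′ = record
      { shape = Reply.shape r ; CF = CF ◂ (nil ∥ nil) ; CB = CB ◂ nil ; c = c′ ; M = delR (addR M c′) c
      ; c∈M = inj₂ refl , (λ { refl → c′∉M c∈M }) ; infFree = InfFree-delR (InfFree-addR infFree)
      ; related = Reply.related r }
    below : ∀ m′ m → + m′ ≤ + m + -1ℤ → m′ ℕ.< m
    below m′ m le = ℤ.drop‿+<+ (ℤ.i≤pred[j]⇒i<j (subst (+ m′ ≤_) (ℤ.+-comm (+ m) -1ℤ) le))

  no-position : ¬ Position
  no-position p = descent∧wf⇒empty descent ℕ.<-wellFounded (measure p) (p , refl)
    where
    descent : Descent ℕ._<_ (λ m → Σ Position λ p → measure p ≡ m)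
    descent (p , refl) = let p′ , p′<p = descend p in measure p′ , p′<p , p′ , refl

  no-bisimulation : ∀ {n} c₁ M → ¬ M e → M c₁ → InfFree M → b ≢ outc → d ≢ outc →
    ¬ R (Γext T inc outc) n (M ▷ Buff inc outc b d c₁) (M ▷ eBuff inc outc b d c₁)
  no-bisimulation {n} c₁ M e∉M c₁∈M inf b≢o d≢o r = no-position record
    { shape = Reply.shape opened ; CF = hole ; CB = hole ; c = c₁ ; M = addR M e ; c∈M = inj₁ c₁∈M
    ; infFree = InfFree-addR inf ; related = Reply.related opened }
    where
    opened : Reply R outc Γ⁺ (n ℕ.+ 0) 0ℤ (addR M e ▷ eBuff inc outc b d c₁)
    opened = answer* isB r (par (frontIn b≢o) (backIn d≢o)) (opening c₁ M e∉M)

open import Data.List.Relation.Unary.All using (_∷_)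
open import Data.List.Relation.Unary.AllPairs using (_∷_)

theorem6p3 : (T : Ty) → ValidT T →
    (inc outc b d c₁ : ℕ) → Unique (inc ∷ outc ∷ b ∷ d ∷ c₁ ∷ []) →
    (M : ℕ → Set) → InfFree M → All M (inc ∷ outc ∷ b ∷ d ∷ c₁ ∷ []) →
    (n : ℕ) →
    ¬ Bisimilar (Γext T inc outc) n
        (M ▷ Buff inc outc b d c₁) (M ▷ eBuff inc outc b d c₁)
theorem6p3 T vT inc outc b d c₁ (_ ∷ (outc≢b ∷ outc≢d ∷ _) ∷ _) M inf (_ ∷ _ ∷ _ ∷ _ ∷ c₁∈M ∷ _) n (R , isB , r) =
  let e , _ , e∉M = inf 0 in
  BufferGame.no-bisimulation T vT inc outc b d e isB c₁ M e∉M c₁∈M inf (≢-sym outc≢b) (≢-sym outc≢d) r
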